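{- Let $\mathbb{L} = (L,\vee,\wedge,{\sim},{^*},0,1)$ be a regular pseudocomplemented Kleene algebra whose underlying lattice $(L,\le)$ is an algebraic lattice. Then there exist a set $U$ and a tolerance $R$ on $U$ induced by an irredundant covering of $U$ such that $\mathbb{L}$ is isomorphic to the rough set algebra $\mathbb{RS} = (\mathit{RS},\vee,\wedge,{\sim},{^*},(\emptyset,\emptyset),(U,U))$ determined by $R$.
   Context: A De Morgan algebra $(L,\vee,\wedge,{\sim},0,1)$ is a bounded distributive lattice with a unary operation ${\sim}$ such that ${\sim}{\sim}x=x$ and $x\le y \iff {\sim}y\le{\sim}x$. It is a Kleene algebra if moreover $x\wedge{\sim}x\le y\vee{\sim}y$ for all $x,y$. A pseudocomplemented Kleene algebra $(L,\vee,\wedge,{\sim},{^*},0,1)$ is a Kleene algebra in which every $x$ has a pseudocomplement $x^*$ (i.e. $x\wedge z=0 \iff z\le x^*$). It then also has dual pseudocomplements $x^+ := {\sim}(({\sim}x)^*)$ (so $x\vee z=1\iff z\ge x^+$). It is called regular if $x^*=y^*$ and $x^+=y^+$ imply $x=y$. A lattice is algebraic if it is complete and every element is the join of the compact elements below it. A tolerance $R$ on a set $U$ is a reflexive symmetric binary relation; $R(x)=\{y\in U\mid x\,R\,y\}$. For $X\subseteq U$: $X^{\downarrow}=\{x\mid R(x)\subseteq X\}$, $X^{\uparrow}=\{x\mid R(x)\cap X\ne\emptyset\}$, and $X^c=U\setminus X$. A covering of $U$ is a family $\mathcal{H}$ of nonempty subsets with $\bigcup\mathcal{H}=U$; it is irredundant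 if $\mathcal{H}\setminus\{X\}$ is not a covering for any $X\in\mathcal{H}$; the tolerance induced by $\mathcal{H}$ is $\bigcup\{X\times X\mid X\in\mathcal{H}\}$. $\mathit{RS}=\{(X^{\downarrow},X^{\uparrow})\mid X\subseteq U\}$ ordered coordinatewise. When $R$ is induced by an irredundant covering, $(\mathit{RS},\le)$ is a complete distributive lattice with meets $\bigwedge (A_i,B_i)=(\bigcap A_i,(\bigcap B_i)^{\downarrow\uparrow})$ and joins $\bigvee(A_i,B_i)=((\bigcup A_i)^{\uparrow\downarrow},\bigcup B_i)$, with ${\sim}(X^{\downarrow},X^{\uparrow})=(X^{c\downarrow},X^{c\uparrow})$, and ${^*}$ the pseudocomplement in this lattice; $\mathbb{RS}$ is then a pseudocomplemented Kleene algebra. -}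

module Defs where

open import Level using (Level; suc; _⊔_; Lift)
open import Data.Product using (Σ; ∃; _×_; _,_; proj₁; proj₂)
open import Data.Unit using (⊤)
open import Data.Empty using (⊥)
open import Data.Sum using (_⊎_)
open import Data.List using (List; []; _∷_; foldr)
open import Data.List.Relation.Unary.All using (All)
open import Relation.Nullary using (¬_)
open import Relation.Binary.PropositionalEquality using (_≡_)
open import Function.Bundles using (_⇔_)

Subset : ∀ {a} → Set a → (b : Level) → Set (a ⊔ suc b)
Subset A b = A → Set b

record PKleeneAlgebra (ℓ : Level) : Set (suc ℓ) where
  infixr 6 _∨_
  infixr 7 _∧_
  infix 8 ∼_
  infix 9 _*
  infix 4 _≤_
  field
    Carrier : Set ℓ
    _∨_ _∧_ : Carrier → Carrier → Carrier
    ∼_ _* : Carrier → Carrier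
    𝟘 𝟙 : Carrier

  _≤_ : Carrier → Carrier → Set ℓ
  x ≤ y = x ∧ y ≡ x

  field
    ∨-assoc : ∀ x y z → (x ∨ y) ∨ z ≡ x ∨ (y ∨ z)
    ∧-assoc : ∀ x y z → (x ∧ y) ∧ z ≡ x ∧ (y ∧ z)
    ∨-comm : ∀ x y → x ∨ y ≡ y ∨ x
    ∧-comm : ∀ x y → x ∧ y ≡ y ∧ x
    ∨-absorbs-∧ : ∀ x y → x ∨ (x ∧ y) ≡ x
    ∧-absorbs-∨ : ∀ x y → x ∧ (x ∨ y) ≡ x
    ∧-distrib-∨ : ∀ x y z → x ∧ (y ∨ z) ≡ (x ∧ y) ∨ (x ∧ z)
    𝟘-least : ∀ x → 𝟘 ≤ x
    𝟙-greatest : ∀ x → x ≤ 𝟙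
    ∼-involutive : ∀ x → ∼ (∼ x) ≡ x
    ∼-antitone : ∀ x y → (x ≤ y) ⇔ (∼ y ≤ ∼ x)
    kleene : ∀ x y → (x ∧ ∼ x) ≤ (y ∨ ∼ y)
    pseudocomplement : ∀ x z → (x ∧ z ≡ 𝟘) ⇔ (z ≤ (x *))

  _⁺ : Carrier → Carrier
  x ⁺ = ∼ ((∼ x) *)

  Regular : Set ℓ
  Regular = ∀ x y → x * ≡ y * → x ⁺ ≡ y ⁺ → x ≡ y

  IsJoin : ∀ {b} → Subset Carrier b → Carrier → Set (ℓ ⊔ b)
  IsJoin S j = (∀ s → S s → s ≤ j) × (∀ u → (∀ s → S s → s ≤ u) → j ≤ u)

  Complete : Set (suc ℓ)
  Complete = ∀ (S : Subset Carrier ℓ) → Σ Carrier (IsJoin S)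

  ⋁fin : List Carrier → Carrier
  ⋁fin = foldr _∨_ 𝟘

  Compact : Carrier → Set (suc ℓ)
  Compact c = ∀ (S : Subset Carrier ℓ) (j : Carrier) → IsJoin S j → c ≤ j →
              Σ (List Carrier) λ F → All S F × (c ≤ ⋁fin F)

  Algebraic : Set (suc ℓ)
  Algebraic = Complete × (∀ x → IsJoin (λ c → Compact c × c ≤ x) x)

_≐_ : ∀ {a b} {A : Set a} → Subset A b → Subset A b → Set (a ⊔ b)
X ≐ Y = ∀ x → X x ⇔ Y x

_⊆_ : ∀ {a b} {A : Set a} → Subset A b → Subset A b → Set (a ⊔ b)
X ⊆ Y = ∀ x → X x → Y x

module Covering {a : Level} (U : Set a) {I : Set a} (H : I → Subset U a) where

  IsCovering : Set a
  IsCovering = (∀ i → ∃ λ x → H i x) × (∀ x → ∃ λ i → H i x)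

  -- removing any member H i (as a set) leaves a family that no longer covers U:
  -- some x is in no member of the family different from H i
  Irredundant : Set a
  Irredundant = ∀ i → ∃ λ x → ∀ j → H j x → H j ≐ H i

  R : U → U → Set a
  R x y = ∃ λ i → H i x × H i y

  _↓ : Subset U a → Subset U a
  (X ↓) x = ∀ y → R x y → X y

  _↑ : Subset U a → Subset U a
  (X ↑) x = ∃ λ y → R x y × X y

  ∁ : Subset U a → Subset U a
  ∁ X x = ¬ X x

  _∪_ _∩_ : Subset U a → Subset U a → Subset U a
  (X ∪ Y) x = X x ⊎ Y x
  (X ∩ Y) x = X x × Y x

  ∅ Full : Subset U a
  ∅ _ = Lift a ⊥
  Full _ = Lift a ⊤

  Pair : Set (suc a)
  Pair = Subset U a × Subset U a

  _≈ₚ_ : Pair → Pair → Set a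
  (A₁ , B₁) ≈ₚ (A₂ , B₂) = (A₁ ≐ A₂) × (B₁ ≐ B₂)

  _≤ₚ_ : Pair → Pair → Set a
  (A₁ , B₁) ≤ₚ (A₂ , B₂) = (A₁ ⊆ A₂) × (B₁ ⊆ B₂)

  InRS : Pair → Set (suc a)
  InRS (A , B) = ∃ λ (X : Subset U a) → (A ≐ (X ↓)) × (B ≐ (X ↑))

  RS : Set (suc a)
  RS = Σ Pair InRS

  _∨ₚ_ : Pair → Pair → Pair
  (A₁ , B₁) ∨ₚ (A₂ , B₂) = (((A₁ ∪ A₂) ↑) ↓ , B₁ ∪ B₂)

  _∧ₚ_ : Pair → Pair → Pair
  (A₁ , B₁) ∧ₚ (A₂ , B₂) = (A₁ ∩ A₂ , ((B₁ ∩ B₂) ↓) ↑)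

  ∼ₚ : RS → Pair
  ∼ₚ (_ , X , _) = (∁ X ↓ , ∁ X ↑)

  𝟘ₚ 𝟙ₚ : Pair
  𝟘ₚ = (∅ , ∅)
  𝟙ₚ = (Full , Full)

  IsPseudocomplementRS : Pair → Pair → Set (suc a)
  IsPseudocomplementRS q p = InRS p × (∀ (Z : RS) → ((q ∧ₚ proj₁ Z) ≈ₚ 𝟘ₚ) ⇔ (proj₁ Z ≤ₚ p))

module _ {ℓ : Level} (𝕃 : PKleeneAlgebra ℓ) {a : Level} (U : Set a) {I : Set a} (H : I → Subset U a) where
  open PKleeneAlgebra 𝕃
  open Covering U H

  IsRSIsomorphism : (Carrier → RS) → Set (ℓ ⊔ suc a)
  IsRSIsomorphism φ =
      (∀ x y → proj₁ (φ x) ≈ₚ proj₁ (φ y) → x ≡ y)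
    × (∀ (Z : RS) → ∃ λ x → proj₁ (φ x) ≈ₚ proj₁ Z)
    × (∀ x y → proj₁ (φ (x ∨ y)) ≈ₚ (proj₁ (φ x) ∨ₚ proj₁ (φ y)))
    × (∀ x y → proj₁ (φ (x ∧ y)) ≈ₚ (proj₁ (φ x) ∧ₚ proj₁ (φ y)))
    × (∀ x → proj₁ (φ (∼ x)) ≈ₚ ∼ₚ (φ x))
    × (∀ x → IsPseudocomplementRS (proj₁ (φ x)) (proj₁ (φ (x *))))
    × (proj₁ (φ 𝟘) ≈ₚ 𝟘ₚ)
    × (proj₁ (φ 𝟙) ≈ₚ 𝟙ₚ)

-- The completely join-prime elements of L are join-dense: given a compact e ≤ x with e ≰ y,
-- Zorn's lemma gives a w ≥ y maximal with e ≰ w, and the meet of the elements not below w is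
-- join-prime. With κ j the largest element not above j, g j = ∼ κ j is an order-reversing
-- involution of the join-primes, and the Kleene law makes each j comparable with g j.
-- Regularity forbids three-element chains of join-primes, so the lower join-primes (j ≤ g j)
-- form an antichain. The covering has one block per lower j, made of a point for j and a point
-- for each strict pair a < g b in which j occurs; x is sent to the rough set whose lower
-- approximation records the j with g j ≤ x and whose upper one the j with j ≤ x.

module Submission where

open import Defs
open import Level using (Level; suc; Lift; lift; lower)
open import Data.Product using (Σ; ∃; _×_; _,_; proj₁; proj₂)
open import Data.Sum using (_⊎_; inj₁; inj₂; reduce)
open import Data.Empty using (⊥; ⊥-elim)
open import Data.Unit using (tt)
open import Data.Bool.Properties using (T-irrelevant)
open import Data.List using ([]; _∷_)
open import Data.List.Relation.Unary.All using (All; []; _∷_)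
open import Relation.Nullary using (¬_; Dec; yes; no)
open import Relation.Nullary.Decidable using (True; toWitness; fromWitness; decidable-stable)
open import Relation.Unary using (｛_｝; _∪_)
open import Relation.Binary.PropositionalEquality
  using (_≡_; _≢_; refl; sym; trans; cong; cong₂; subst; subst₂; module ≡-Reasoning)
open import Function.Base using (_∘_)
open import Function.Bundles using (_⇔_; mk⇔; Equivalence)
open import Function.Construct.Symmetry using (⇔-sym)
open import Function.Construct.Composition using (_⇔-∘_)
open import Function.Construct.Identity using (⇔-id)
open import Function.Related.Propositional using (module EquationalReasoning; equivalence)
open import Axiom.ExcludedMiddle using (ExcludedMiddle)

open Equivalence using (to; from)

module Classical (lem : ∀ {b} → ExcludedMiddle b) where

  dne : ∀ {b} {P : Set b} → ¬ ¬ P → P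
  dne = decidable-stable lem

  -- A proof-irrelevant copy of P at an arbitrary level, obtained by storing only the
  -- boolean verdict of excluded middle.
  Resize : ∀ {b} (c : Level) → Set b → Set c
  Resize c P = Lift c (True (lem {P = P}))

  resize : ∀ {b c} {P : Set b} → P → Resize c P
  resize p = lift (fromWitness p)

  unresize : ∀ {b c} {P : Set b} → Resize c P → P
  unresize r = toWitness (lower r)

  Resize-irrelevant : ∀ {b c} {P : Set b} (r r′ : Resize c P) → r ≡ r′
  Resize-irrelevant (lift t) (lift t′) = cong lift (T-irrelevant t t′)

module LatticeProperties {ℓ} (𝕃 : PKleeneAlgebra ℓ) where
  open PKleeneAlgebra 𝕃

  ≤-reflexive : ∀ {x y} → x ≡ y → x ≤ y
  ≤-reflexive {x} refl = begin
    x ∧ x            ≡⟨ cong (x ∧_) (∨-absorbs-∧ x x) ⟨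
    x ∧ (x ∨ x ∧ x)  ≡⟨ ∧-absorbs-∨ x (x ∧ x) ⟩
    x                ∎
    where open ≡-Reasoning

  ≤-refl : ∀ {x} → x ≤ x
  ≤-refl = ≤-reflexive refl

  ≤-trans : ∀ {x y z} → x ≤ y → y ≤ z → x ≤ z
  ≤-trans {x} {y} {z} x≤y y≤z = begin
    x ∧ z        ≡⟨ cong (_∧ z) x≤y ⟨
    (x ∧ y) ∧ z  ≡⟨ ∧-assoc x y z ⟩
    x ∧ (y ∧ z)  ≡⟨ cong (x ∧_) y≤z ⟩
    x ∧ y        ≡⟨ x≤y ⟩
    x            ∎
    where open ≡-Reasoning

  ≤-antisym : ∀ {x y} → x ≤ y → y ≤ x → x ≡ y
  ≤-antisym {x} {y} x≤y y≤x = trans (sym x≤y) (trans (∧-comm x y) y≤x)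

  x∧y≤x : ∀ {x y} → x ∧ y ≤ x
  x∧y≤x {x} {y} = begin
    (x ∧ y) ∧ x  ≡⟨ ∧-assoc x y x ⟩
    x ∧ (y ∧ x)  ≡⟨ cong (x ∧_) (∧-comm y x) ⟩
    x ∧ (x ∧ y)  ≡⟨ ∧-assoc x x y ⟨
    (x ∧ x) ∧ y  ≡⟨ cong (_∧ y) ≤-refl ⟩
    x ∧ y        ∎
    where open ≡-Reasoning

  x∧y≤y : ∀ {x y} → x ∧ y ≤ y
  x∧y≤y {x} {y} = subst (_≤ y) (∧-comm y x) x∧y≤x

  ∧-greatest : ∀ {x y z} → z ≤ x → z ≤ y → z ≤ x ∧ y
  ∧-greatest {x} {y} {z} z≤x z≤y = trans (sym (∧-assoc z x y)) (trans (cong (_∧ y) z≤x) z≤y)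

  ∧-monoˡ-≤ : ∀ {x y z} → x ≤ y → x ∧ z ≤ y ∧ z
  ∧-monoˡ-≤ x≤y = ∧-greatest (≤-trans x∧y≤x x≤y) x∧y≤y

  x≤x∨y : ∀ {x y} → x ≤ x ∨ y
  x≤x∨y {x} {y} = ∧-absorbs-∨ x y

  y≤x∨y : ∀ {x y} → y ≤ x ∨ y
  y≤x∨y {x} {y} = subst (y ≤_) (∨-comm y x) x≤x∨y

  ∨-least : ∀ {x y z} → x ≤ z → y ≤ z → x ∨ y ≤ z
  ∨-least {x} {y} {z} x≤z y≤z = ∨≡⇒≤ (begin
    (x ∨ y) ∨ z  ≡⟨ ∨-assoc x y z ⟩
    x ∨ (y ∨ z)  ≡⟨ cong (x ∨_) (≤⇒∨≡ y≤z) ⟩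
    x ∨ z        ≡⟨ ≤⇒∨≡ x≤z ⟩
    z            ∎)
    where
    open ≡-Reasoning
    ≤⇒∨≡ : ∀ {a b} → a ≤ b → a ∨ b ≡ b
    ≤⇒∨≡ {a} {b} a≤b = begin
      a ∨ b        ≡⟨ cong (_∨ b) (trans (sym a≤b) (∧-comm a b)) ⟩
      b ∧ a ∨ b    ≡⟨ ∨-comm (b ∧ a) b ⟩
      b ∨ b ∧ a    ≡⟨ ∨-absorbs-∧ b a ⟩
      b            ∎
    ∨≡⇒≤ : ∀ {a b} → a ∨ b ≡ b → a ≤ b
    ∨≡⇒≤ {a} {b} a∨b≡b = trans (cong (a ∧_) (sym a∨b≡b)) (∧-absorbs-∨ a b)

  ≤𝟘⇒≡𝟘 : ∀ {x} → x ≤ 𝟘 → x ≡ 𝟘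
  ≤𝟘⇒≡𝟘 {x} x≤𝟘 = ≤-antisym x≤𝟘 (𝟘-least x)

  x∧𝟘≡𝟘 : ∀ x → x ∧ 𝟘 ≡ 𝟘
  x∧𝟘≡𝟘 x = trans (∧-comm x 𝟘) (𝟘-least x)

  ∼-reverse : ∀ {x y} → x ≤ y → ∼ y ≤ ∼ x
  ∼-reverse {x} {y} = to (∼-antitone x y)

  ∼-reflect : ∀ {x y} → ∼ y ≤ ∼ x → x ≤ y
  ∼-reflect {x} {y} = from (∼-antitone x y)

  ∼-swapˡ : ∀ {x y} → ∼ x ≤ y → ∼ y ≤ x
  ∼-swapˡ {x} {y} ∼x≤y = subst (∼ y ≤_) (∼-involutive x) (∼-reverse ∼x≤y)

  ∼-swapʳ : ∀ {x y} → x ≤ ∼ y → y ≤ ∼ x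
  ∼-swapʳ {x} {y} x≤∼y = subst (_≤ ∼ x) (∼-involutive y) (∼-reverse x≤∼y)

  ∼-∨ : ∀ x y → ∼ (x ∨ y) ≡ ∼ x ∧ ∼ y
  ∼-∨ x y = ≤-antisym (∧-greatest (∼-reverse x≤x∨y) (∼-reverse y≤x∨y))
                      (∼-swapʳ (∨-least (∼-swapʳ x∧y≤x) (∼-swapʳ x∧y≤y)))

  ∼-∧ : ∀ x y → ∼ (x ∧ y) ≡ ∼ x ∨ ∼ y
  ∼-∧ x y = begin
    ∼ (x ∧ y)              ≡⟨ cong ∼_ (cong₂ _∧_ (∼-involutive x) (∼-involutive y)) ⟨
    ∼ (∼ ∼ x ∧ ∼ ∼ y)      ≡⟨ cong ∼_ (∼-∨ (∼ x) (∼ y)) ⟨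
    ∼ ∼ (∼ x ∨ ∼ y)        ≡⟨ ∼-involutive (∼ x ∨ ∼ y) ⟩
    ∼ x ∨ ∼ y              ∎
    where open ≡-Reasoning

  ∼𝟘≡𝟙 : ∼ 𝟘 ≡ 𝟙
  ∼𝟘≡𝟙 = ≤-antisym (𝟙-greatest (∼ 𝟘)) (∼-swapʳ (𝟘-least (∼ 𝟙)))

  ∼𝟙≡𝟘 : ∼ 𝟙 ≡ 𝟘
  ∼𝟙≡𝟘 = trans (cong ∼_ (sym ∼𝟘≡𝟙)) (∼-involutive 𝟘)

  annihilator-antitone : ∀ {x y z} → x ≤ y → y ∧ z ≡ 𝟘 → x ∧ z ≡ 𝟘
  annihilator-antitone x≤y y∧z≡𝟘 = ≤𝟘⇒≡𝟘 (≤-trans (∧-monoˡ-≤ x≤y) (≤-reflexive y∧z≡𝟘))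

  annihilators-⊆⇒*≤ : ∀ {x y} → (∀ {z} → x ∧ z ≡ 𝟘 → y ∧ z ≡ 𝟘) → x * ≤ y *
  annihilators-⊆⇒*≤ {x} {y} ann =
    to (pseudocomplement y (x *)) (ann (from (pseudocomplement x (x *)) ≤-refl))

  CompletelyJoinPrime : Carrier → Set (suc ℓ)
  CompletelyJoinPrime j =
    ∀ (S : Subset Carrier ℓ) s → IsJoin S s → j ≤ s → ∃ λ t → S t × j ≤ t

  joinPrime⇒≰𝟘 : ∀ {j} → CompletelyJoinPrime j → ¬ j ≤ 𝟘
  joinPrime⇒≰𝟘 jp j≤𝟘 with jp (λ _ → Lift ℓ ⊥) 𝟘 ((λ _ ()) , λ u _ → 𝟘-least u) j≤𝟘
  ... | _ , () , _

  ∨-isJoin : ∀ {x y} → IsJoin (λ z → z ≡ x ⊎ z ≡ y) (x ∨ y)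
  ∨-isJoin = (λ { _ (inj₁ refl) → x≤x∨y ; _ (inj₂ refl) → y≤x∨y })
           , λ u ub → ∨-least (ub _ (inj₁ refl)) (ub _ (inj₂ refl))

  joinPrime-∨ : ∀ {j x y} → CompletelyJoinPrime j → j ≤ x ∨ y → j ≤ x ⊎ j ≤ y
  joinPrime-∨ jp j≤x∨y with jp _ _ ∨-isJoin j≤x∨y
  ... | _ , inj₁ refl , j≤x = inj₁ j≤x
  ... | _ , inj₂ refl , j≤y = inj₂ j≤y

  IsChain : Subset Carrier ℓ → Set ℓ
  IsChain S = ∀ {s t} → S s → S t → s ≤ t ⊎ t ≤ s

  ∧-⋁fin-≤ : ∀ {b} {S : Subset Carrier b} {x u} F → All S F →
             (∀ s → S s → x ∧ s ≤ u) → x ∧ ⋁fin F ≤ u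
  ∧-⋁fin-≤ {x = x} {u} [] [] _ = ≤-trans x∧y≤y (𝟘-least u)
  ∧-⋁fin-≤ {x = x} (f ∷ F) (f∈S ∷ F⊆S) bound =
    subst (_≤ _) (sym (∧-distrib-∨ x f (⋁fin F))) (∨-least (bound f f∈S) (∧-⋁fin-≤ F F⊆S bound))

  ⋁fin-bounded-in-chain : ∀ {y S} → IsChain S → (∀ {s} → S s → y ≤ s) →
                          ∀ F → All (｛ y ｝ ∪ S) F → ⋁fin F ≤ y ⊎ ∃ λ s → S s × ⋁fin F ≤ s
  ⋁fin-bounded-in-chain {y} {S} chain y≤ [] [] = inj₁ (𝟘-least y)
  ⋁fin-bounded-in-chain {y} {S} chain y≤ (f ∷ F) (f∈ ∷ F⊆) =
    add f∈ (⋁fin-bounded-in-chain chain y≤ F F⊆)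
    where
    add : ∀ {f} → (｛ y ｝ ∪ S) f → ⋁fin F ≤ y ⊎ (∃ λ s → S s × ⋁fin F ≤ s) →
          f ∨ ⋁fin F ≤ y ⊎ ∃ λ s → S s × f ∨ ⋁fin F ≤ s
    add (inj₁ refl) (inj₁ F≤y)          = inj₁ (∨-least ≤-refl F≤y)
    add (inj₁ refl) (inj₂ (s , s∈S , F≤s)) = inj₂ (s , s∈S , ∨-least (y≤ s∈S) F≤s)
    add (inj₂ f∈S) (inj₁ F≤y)           = inj₂ (_ , f∈S , ∨-least ≤-refl (≤-trans F≤y (y≤ f∈S)))
    add (inj₂ f∈S) (inj₂ (s , s∈S , F≤s)) with chain f∈S s∈S
    ... | inj₁ f≤s = inj₂ (s , s∈S , ∨-least f≤s F≤s)
    ... | inj₂ s≤f = inj₂ (_ , f∈S , ∨-least ≤-refl (≤-trans F≤s s≤f))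

module CompleteLatticeProperties (lem : ∀ {b} → ExcludedMiddle b) {ℓ} (𝕃 : PKleeneAlgebra ℓ)
  (complete : PKleeneAlgebra.Complete 𝕃) where
  open PKleeneAlgebra 𝕃
  open LatticeProperties 𝕃
  open Classical lem

  sup : Subset Carrier ℓ → Carrier
  sup S = proj₁ (complete S)

  sup-isJoin : ∀ S → IsJoin S (sup S)
  sup-isJoin S = proj₂ (complete S)

  ≤-sup : ∀ {S s} → S s → s ≤ sup S
  ≤-sup {S} {s} = proj₁ (sup-isJoin S) s

  sup-least : ∀ {S u} → (∀ s → S s → s ≤ u) → sup S ≤ u
  sup-least {S} {u} = proj₂ (sup-isJoin S) u

  joinPrime-≤sup : ∀ {j S} → CompletelyJoinPrime j → j ≤ sup S → ∃ λ s → S s × j ≤ s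
  joinPrime-≤sup {S = S} jp = jp S (sup S) (sup-isJoin S)

  κ : Carrier → Carrier
  κ j = sup (λ z → ¬ j ≤ z)

  ≰⇒≤κ : ∀ {j z} → ¬ j ≤ z → z ≤ κ j
  ≰⇒≤κ = ≤-sup

  ≰κ⇒≥ : ∀ {j z} → ¬ z ≤ κ j → j ≤ z
  ≰κ⇒≥ z≰κj = dne λ j≰z → z≰κj (≰⇒≤κ j≰z)

  joinPrime⇒≰κ : ∀ {j} → CompletelyJoinPrime j → ¬ j ≤ κ j
  joinPrime⇒≰κ jp j≤κj with joinPrime-≤sup jp j≤κj
  ... | _ , j≰t , j≤t = j≰t j≤t

  g : Carrier → Carrier
  g j = ∼ κ j

  g≤⇒≰∼ : ∀ {j y} → CompletelyJoinPrime j → g j ≤ y → ¬ j ≤ ∼ y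
  g≤⇒≰∼ jp gj≤y j≤∼y = joinPrime⇒≰κ jp (≤-trans j≤∼y (∼-swapˡ gj≤y))

  ≰∼⇒g≤ : ∀ {j y} → ¬ j ≤ ∼ y → g j ≤ y
  ≰∼⇒g≤ j≰∼y = ∼-swapˡ (≰⇒≤κ j≰∼y)

  g≤∼⇒≰ : ∀ {j x} → CompletelyJoinPrime j → g j ≤ ∼ x → ¬ j ≤ x
  g≤∼⇒≰ {j} {x} jp gj≤∼x j≤x = g≤⇒≰∼ jp gj≤∼x (subst (j ≤_) (sym (∼-involutive x)) j≤x)

  ≰⇒g≤∼ : ∀ {j x} → ¬ j ≤ x → g j ≤ ∼ x
  ≰⇒g≤∼ {j} {x} j≰x = ≰∼⇒g≤ λ j≤∼∼x → j≰x (subst (j ≤_) (∼-involutive x) j≤∼∼x)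

  g-joinPrime : ∀ {j} → CompletelyJoinPrime j → CompletelyJoinPrime (g j)
  g-joinPrime {j} jp S s (ub , least) gj≤s with lem {P = ∃ λ t → S t × ¬ j ≤ ∼ t}
  ... | yes (t , t∈S , j≰∼t) = t , t∈S , ≰∼⇒g≤ j≰∼t
  ... | no ∄t = ⊥-elim (g≤⇒≰∼ jp gj≤s (∼-swapʳ (least (∼ j) λ t t∈S →
                  ∼-swapʳ (dne λ j≰∼t → ∄t (t , t∈S , j≰∼t)))))

  g-involutive : ∀ {j} → CompletelyJoinPrime j → g (g j) ≡ j
  g-involutive {j} jp = ≤-antisym ggj≤j j≤ggj
    where
    ggj≤j : g (g j) ≤ j
    ggj≤j = ≰∼⇒g≤ λ gj≤∼j → g≤⇒≰∼ jp gj≤∼j (≤-reflexive (sym (∼-involutive j)))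
    j≤ggj : j ≤ g (g j)
    j≤ggj = dne λ j≰ggj → g≤⇒≰∼ (g-joinPrime jp) ≤-refl
              (≰∼⇒g≤ λ j≤∼∼ggj → j≰ggj (subst (j ≤_) (∼-involutive (g (g j))) j≤∼∼ggj))

  g-antitone : ∀ {j k} → CompletelyJoinPrime j → j ≤ k → g k ≤ g j
  g-antitone jp j≤k = ≰∼⇒g≤ λ k≤∼gj → g≤⇒≰∼ jp ≤-refl (≤-trans j≤k k≤∼gj)

  ≤∼⇒g≰ : ∀ {j x} → CompletelyJoinPrime j → j ≤ ∼ x → ¬ g j ≤ x
  ≤∼⇒g≰ {x = x} jp j≤∼x = g≤∼⇒≰ (g-joinPrime jp) (subst (_≤ ∼ x) (sym (g-involutive jp)) j≤∼x)

  g≰⇒≤∼ : ∀ {j x} → CompletelyJoinPrime j → ¬ g j ≤ x → j ≤ ∼ x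
  g≰⇒≤∼ {x = x} jp gj≰x = subst (_≤ ∼ x) (g-involutive jp) (≰⇒g≤∼ gj≰x)

  -- The Kleene inequality j ∧ ∼ j ≤ g j ∨ ∼ g j makes j and g j comparable.
  joinPrime-≤g⊎g≤ : ∀ {j} → CompletelyJoinPrime j → j ≤ g j ⊎ g j ≤ j
  joinPrime-≤g⊎g≤ {j} jp with lem {P = g j ≤ j}
  ... | yes gj≤j = inj₂ gj≤j
  ... | no gj≰j = comparable (joinPrime-∨ jp (≤-trans (∧-greatest ≤-refl j≤∼j) (kleene j (g j))))
    where
    j≤∼j : j ≤ ∼ j
    j≤∼j = dne λ j≰∼j → gj≰j (≰∼⇒g≤ j≰∼j)
    comparable : j ≤ g j ⊎ j ≤ ∼ g j → j ≤ g j ⊎ g j ≤ j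
    comparable (inj₁ j≤gj)  = inj₁ j≤gj
    comparable (inj₂ j≤∼gj) = ⊥-elim (g≤⇒≰∼ jp ≤-refl j≤∼gj)

  -- Zorn's lemma, via the Bourbaki–Witt tower of a choice of strict successors.
  module Zorn (y : Carrier) (M : Carrier → Set ℓ)
    (M-chain-closed : ∀ S → IsChain S → (∀ {s} → S s → y ≤ s × M s) → M (sup (｛ y ｝ ∪ S))) where

    Extendable : Carrier → Set ℓ
    Extendable z = ∃ λ w → M w × z ≤ w × z ≢ w

    successor : ∀ z → Dec (Extendable z) → Carrier
    successor z (yes (w , _)) = w
    successor z (no _)        = z

    next : Carrier → Carrier
    next z = successor z lem

    next-inflationary : ∀ z → z ≤ next z
    next-inflationary z = inflationary lem
      where
      inflationary : ∀ d → z ≤ successor z d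
      inflationary (yes (_ , _ , z≤w , _)) = z≤w
      inflationary (no _)                   = ≤-refl

    next-preserves-M : ∀ {z} → M z → M (next z)
    next-preserves-M {z} = preserves lem
      where
      preserves : ∀ d → M z → M (successor z d)
      preserves (yes (_ , Mw , _)) _  = Mw
      preserves (no _)             Mz = Mz

    next≤⇒¬Extendable : ∀ z → next z ≤ z → ¬ Extendable z
    next≤⇒¬Extendable z = stuck lem
      where
      stuck : ∀ d → successor z d ≤ z → ¬ Extendable z
      stuck (yes (_ , _ , z≤w , z≢w)) w≤z _ = z≢w (≤-antisym z≤w w≤z)
      stuck (no ¬ext)                 _   = ¬ext

    data Tower : Carrier → Set (suc ℓ) where
      tower-sup  : (S : Subset Carrier ℓ) → (∀ {s} → S s → Tower s) → Tower (sup (｛ y ｝ ∪ S))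
      tower-next : ∀ {z} → Tower z → Tower (next z)

    tower-≥y : ∀ {z} → Tower z → y ≤ z
    tower-≥y (tower-sup S _)      = ≤-sup (inj₁ refl)
    tower-≥y (tower-next {z} Tz) = ≤-trans (tower-≥y Tz) (next-inflationary z)

    Extreme : Carrier → Set (suc ℓ)
    Extreme z = ∀ {t} → Tower t → t ≤ z → t ≢ z → next t ≤ z

    extreme-splits : ∀ {z} → Tower z → Extreme z → ∀ {t} → Tower t → t ≤ z ⊎ next z ≤ t
    extreme-splits {z} Tz ext (tower-sup S TS) with lem {P = ∃ λ s → S s × next z ≤ s}
    ... | yes (s , s∈S , nz≤s) = inj₂ (≤-trans nz≤s (≤-sup (inj₂ s∈S)))
    ... | no ∄s = inj₁ (sup-least λ { _ (inj₁ refl) → tower-≥y Tz ; s (inj₂ s∈S) → below s∈S })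
      where
      below : ∀ {s} → S s → s ≤ z
      below {s} s∈S with extreme-splits Tz ext (TS s∈S)
      ... | inj₁ s≤z  = s≤z
      ... | inj₂ nz≤s = ⊥-elim (∄s (s , s∈S , nz≤s))
    extreme-splits {z} Tz ext (tower-next {t} Tt) with extreme-splits Tz ext Tt
    ... | inj₂ nz≤t = inj₂ (≤-trans nz≤t (next-inflationary t))
    ... | inj₁ t≤z with lem {P = t ≡ z}
    ...   | yes refl = inj₂ ≤-refl
    ...   | no t≢z  = inj₁ (ext Tt t≤z t≢z)

    tower-extreme : ∀ {z} → Tower z → Extreme z
    tower-extreme Tz@(tower-sup S TS) {t} Tt t≤z t≢z
      with lem {P = ∃ λ s → S s × ¬ next s ≤ t}
    ... | no ∄s = ⊥-elim (t≢z (≤-antisym t≤z (sup-least λ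
            { _ (inj₁ refl) → tower-≥y Tt
            ; s (inj₂ s∈S) → ≤-trans (next-inflationary s) (dne λ ns≰t → ∄s (s , s∈S , ns≰t)) })))
    ... | yes (s , s∈S , ns≰t) with extreme-splits (TS s∈S) (tower-extreme (TS s∈S)) Tt
    ...   | inj₂ ns≤t = ⊥-elim (ns≰t ns≤t)
    ...   | inj₁ t≤s with lem {P = t ≡ s}
    ...     | no t≢s = ≤-trans (tower-extreme (TS s∈S) Tt t≤s t≢s) (≤-sup (inj₂ s∈S))
    ...     | yes refl with extreme-splits (TS s∈S) (tower-extreme (TS s∈S)) Tz
    ...       | inj₁ z≤t  = ⊥-elim (t≢z (≤-antisym t≤z z≤t))
    ...       | inj₂ nt≤z = nt≤z
    tower-extreme (tower-next {z} Tz) {t} Tt t≤nz t≢nz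
      with extreme-splits Tz (tower-extreme Tz) Tt
    ... | inj₂ nz≤t = ⊥-elim (t≢nz (≤-antisym t≤nz nz≤t))
    ... | inj₁ t≤z with lem {P = t ≡ z}
    ...   | yes refl = ≤-refl
    ...   | no t≢z  = ≤-trans (tower-extreme Tz Tt t≤z t≢z) (next-inflationary z)

    tower-chain : ∀ {z t} → Tower z → Tower t → z ≤ t ⊎ t ≤ z
    tower-chain {z} Tz Tt with extreme-splits Tz (tower-extreme Tz) Tt
    ... | inj₁ t≤z  = inj₂ t≤z
    ... | inj₂ nz≤t = inj₁ (≤-trans (next-inflationary z) nz≤t)

    tower-M : ∀ {z} → Tower z → M z
    tower-M (tower-sup S TS) = M-chain-closed S (λ s∈S t∈S → tower-chain (TS s∈S) (TS t∈S))
                                 (λ s∈S → tower-≥y (TS s∈S) , tower-M (TS s∈S))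
    tower-M (tower-next Tz)  = next-preserves-M (tower-M Tz)

    top : Carrier
    top = sup (｛ y ｝ ∪ λ z → Resize ℓ (Tower z))

    tower-top : Tower top
    tower-top = tower-sup _ unresize

    maximal : ∃ λ w → y ≤ w × M w × (∀ {w′} → M w′ → w ≤ w′ → w ≡ w′)
    maximal = top , tower-≥y tower-top , tower-M tower-top , λ Mw′ top≤w′ → dne λ top≢w′ →
      next≤⇒¬Extendable top (≤-sup (inj₂ (resize (tower-next tower-top))))
        (_ , Mw′ , top≤w′ , top≢w′)

module AlgebraicLatticeProperties (lem : ∀ {b} → ExcludedMiddle b) {ℓ} (𝕃 : PKleeneAlgebra ℓ)
  (algebraic : PKleeneAlgebra.Algebraic 𝕃) where
  open PKleeneAlgebra 𝕃
  open LatticeProperties 𝕃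
  open Classical lem
  open CompleteLatticeProperties lem 𝕃 (proj₁ algebraic) public

  compacts-below-join : ∀ x → IsJoin (λ c → Compact c × c ≤ x) x
  compacts-below-join = proj₂ algebraic

  ∧-sup-≤ : ∀ {S x u} → (∀ s → S s → x ∧ s ≤ u) → x ∧ sup S ≤ u
  ∧-sup-≤ {S} {x} {u} bound = proj₂ (compacts-below-join (x ∧ sup S)) u λ c (compact , c≤) →
    let (F , F⊆S , c≤⋁F) = compact S (sup S) (sup-isJoin S) (≤-trans c≤ x∧y≤y)
    in ≤-trans (∧-greatest (≤-trans c≤ x∧y≤x) c≤⋁F) (∧-⋁fin-≤ F F⊆S bound)

  compact-≰-chain-sup : ∀ {e y S} → Compact e → ¬ e ≤ y → IsChain S →
                        (∀ {s} → S s → y ≤ s × ¬ e ≤ s) → ¬ e ≤ sup (｛ y ｝ ∪ S)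
  compact-≰-chain-sup {e} {y} {S} compact e≰y chain above e≤sup
    with compact (｛ y ｝ ∪ S) _ (sup-isJoin _) e≤sup
  ... | F , F⊆ , e≤⋁F with ⋁fin-bounded-in-chain chain (λ s∈S → proj₁ (above s∈S)) F F⊆
  ...   | inj₁ ⋁F≤y               = e≰y (≤-trans e≤⋁F ⋁F≤y)
  ...   | inj₂ (s , s∈S , ⋁F≤s) = proj₂ (above s∈S) (≤-trans e≤⋁F ⋁F≤s)

  -- w is chosen maximal among the elements above y and not above e.
  maximal-avoiding : ∀ {e y} → Compact e → ¬ e ≤ y →
                     ∃ λ w → y ≤ w × ¬ e ≤ w × (∀ {t} → ¬ t ≤ w → e ≤ w ∨ t)
  maximal-avoiding {e} {y} compact e≰y
    with Zorn.maximal y (λ w → ¬ e ≤ w) (λ S chain above → compact-≰-chain-sup compact e≰y chain above)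
  ... | w , y≤w , e≰w , max = w , y≤w , e≰w , λ {t} t≰w → dne λ e≰w∨t →
          t≰w (subst (t ≤_) (sym (max e≰w∨t x≤x∨y)) y≤x∨y)

  joinPrime-dense : ∀ {x y} → ¬ x ≤ y → ∃ λ j → CompletelyJoinPrime j × j ≤ x × ¬ j ≤ y
  joinPrime-dense {x} {y} x≰y with lem {P = ∃ λ c → Compact c × c ≤ x × ¬ c ≤ y}
  ... | no ∄c = ⊥-elim (x≰y (proj₂ (compacts-below-join x) y λ c (compact , c≤x) →
                  dne λ c≰y → ∄c (c , compact , c≤x , c≰y)))
  ... | yes (e , compact , e≤x , e≰y) with maximal-avoiding compact e≰y
  ...   | w , y≤w , e≰w , e≤w∨ = j , j-joinPrime , j≤x , λ j≤y → j≰w (≤-trans j≤y y≤w)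
    where
    -- j is the meet of all elements not below w.
    ∼NotBelow : Subset Carrier ℓ
    ∼NotBelow z = ¬ ∼ z ≤ w

    j : Carrier
    j = ∼ sup ∼NotBelow

    ≰w⇒j≤ : ∀ {t} → ¬ t ≤ w → j ≤ t
    ≰w⇒j≤ {t} t≰w = ∼-swapˡ (≤-sup (subst (λ v → ¬ v ≤ w) (sym (∼-involutive t)) t≰w))

    ∼w∧s≤∼e : ∀ s → ∼NotBelow s → ∼ w ∧ s ≤ ∼ e
    ∼w∧s≤∼e s ∼s≰w = subst (_≤ ∼ e) (trans (∼-∨ w (∼ s)) (cong (∼ w ∧_) (∼-involutive s)))
                           (∼-reverse (e≤w∨ ∼s≰w))

    j≰w : ¬ j ≤ w
    j≰w j≤w = e≰w (∼-reflect (≤-trans (∧-greatest ≤-refl (∼-swapˡ j≤w)) (∧-sup-≤ ∼w∧s≤∼e)))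

    j≤x : j ≤ x
    j≤x = ≰w⇒j≤ λ x≤w → e≰w (≤-trans e≤x x≤w)

    j-joinPrime : CompletelyJoinPrime j
    j-joinPrime S s (_ , least) j≤s with lem {P = ∃ λ t → S t × ¬ t ≤ w}
    ... | yes (t , t∈S , t≰w) = t , t∈S , ≰w⇒j≤ t≰w
    ... | no ∄t = ⊥-elim (j≰w (≤-trans j≤s (least w λ t t∈S → dne λ t≰w → ∄t (t , t∈S , t≰w))))

  ≤-by-joinPrimes : ∀ {x y} → (∀ {j} → CompletelyJoinPrime j → j ≤ x → j ≤ y) → x ≤ y
  ≤-by-joinPrimes below = dne λ x≰y →
    let (j , jp , j≤x , j≰y) = joinPrime-dense x≰y in j≰y (below jp j≤x)

module RegularAlgebraicProperties (lem : ∀ {b} → ExcludedMiddle b) {ℓ} (𝕃 : PKleeneAlgebra ℓ)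
  (regular : PKleeneAlgebra.Regular 𝕃) (algebraic : PKleeneAlgebra.Algebraic 𝕃) where
  open PKleeneAlgebra 𝕃
  open LatticeProperties 𝕃
  open Classical lem
  open AlgebraicLatticeProperties lem 𝕃 algebraic public

  -- Regularity is applied to k and y = k ∧ κ k: the element j below k makes their pseudocomplements
  -- agree, the element l above k makes both dual pseudocomplements equal to 𝟙.
  no-joinPrime-3-chain : ∀ {j k l} →
    CompletelyJoinPrime j → CompletelyJoinPrime k → CompletelyJoinPrime l →
    j ≤ k → k ≤ l → j ≢ k → k ≢ l → ⊥
  no-joinPrime-3-chain {j} {k} {l} jp-j jp-k jp-l j≤k k≤l j≢k k≢l =
    joinPrime⇒≰κ jp-k (subst (_≤ κ k) (sym k≡y) x∧y≤y)
    where
    y : Carrier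
    y = k ∧ κ k

    below-k : ∀ {m} → m ≤ k → m ≤ y ⊎ k ≤ m
    below-k {m} m≤k with lem {P = m ≤ κ k}
    ... | yes m≤κk = inj₁ (∧-greatest m≤k m≤κk)
    ... | no m≰κk  = inj₂ (≰κ⇒≥ m≰κk)

    annihilators-y⊆k : ∀ {z} → y ∧ z ≡ 𝟘 → k ∧ z ≡ 𝟘
    annihilators-y⊆k {z} y∧z≡𝟘 = ≤𝟘⇒≡𝟘 (≤-by-joinPrimes λ {m} _ m≤k∧z →
      ≤-trans (∧-greatest (below m≤k∧z) (≤-trans m≤k∧z x∧y≤y)) (≤-reflexive y∧z≡𝟘))
      where
      below : ∀ {m} → m ≤ k ∧ z → m ≤ y
      below {m} m≤k∧z with below-k (≤-trans m≤k∧z x∧y≤x)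
      ... | inj₁ m≤y = m≤y
      ... | inj₂ k≤m = ⊥-elim (joinPrime⇒≰𝟘 jp-j (≤-trans (∧-greatest j≤y j≤z) (≤-reflexive y∧z≡𝟘)))
        where
        j≤y : j ≤ y
        j≤y = ∧-greatest j≤k (≰⇒≤κ λ k≤j → j≢k (≤-antisym j≤k k≤j))
        j≤z : j ≤ z
        j≤z = ≤-trans j≤k (≤-trans k≤m (≤-trans m≤k∧z x∧y≤y))

    k∨∼z≡𝟙 : ∀ {z} → ∼ k ∧ z ≡ 𝟘 → k ∨ ∼ z ≡ 𝟙
    k∨∼z≡𝟙 {z} ∼k∧z≡𝟘 = begin
      k ∨ ∼ z        ≡⟨ cong (_∨ ∼ z) (∼-involutive k) ⟨
      ∼ ∼ k ∨ ∼ z    ≡⟨ ∼-∧ (∼ k) z ⟨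
      ∼ (∼ k ∧ z)    ≡⟨ cong ∼_ ∼k∧z≡𝟘 ⟩
      ∼ 𝟘            ≡⟨ ∼𝟘≡𝟙 ⟩
      𝟙              ∎
      where open ≡-Reasoning

    annihilators-∼k-trivial : ∀ {z} → ∼ k ∧ z ≡ 𝟘 → z ≡ 𝟘
    annihilators-∼k-trivial {z} ∼k∧z≡𝟘
      with joinPrime-∨ jp-l (≤-trans (𝟙-greatest l) (≤-reflexive (sym (k∨∼z≡𝟙 ∼k∧z≡𝟘))))
    ... | inj₁ l≤k  = ⊥-elim (k≢l (≤-antisym k≤l l≤k))
    ... | inj₂ l≤∼z = ≤𝟘⇒≡𝟘 (subst (z ≤_) ∼𝟙≡𝟘 (∼-swapʳ 𝟙≤∼z))
      where
      𝟙≤∼z : 𝟙 ≤ ∼ z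
      𝟙≤∼z = subst (_≤ ∼ z) (k∨∼z≡𝟙 ∼k∧z≡𝟘) (∨-least (≤-trans k≤l l≤∼z) ≤-refl)

    annihilators-∼k⊆∼y : ∀ {z} → ∼ k ∧ z ≡ 𝟘 → ∼ y ∧ z ≡ 𝟘
    annihilators-∼k⊆∼y ∼k∧z≡𝟘 =
      subst (λ z → ∼ y ∧ z ≡ 𝟘) (sym (annihilators-∼k-trivial ∼k∧z≡𝟘)) (x∧𝟘≡𝟘 (∼ y))

    k≡y : k ≡ y
    k≡y = regular k y
      (≤-antisym (annihilators-⊆⇒*≤ (annihilator-antitone x∧y≤x)) (annihilators-⊆⇒*≤ annihilators-y⊆k))
      (cong ∼_ (≤-antisym (annihilators-⊆⇒*≤ annihilators-∼k⊆∼y)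
                          (annihilators-⊆⇒*≤ (annihilator-antitone (∼-reverse x∧y≤x)))))

  IsLower : Carrier → Set (suc ℓ)
  IsLower j = CompletelyJoinPrime j × j ≤ g j

  lower-antichain : ∀ {a b} → IsLower a → IsLower b → a ≤ b → a ≡ b
  lower-antichain {a} {b} (jp-a , _) (jp-b , b≤gb) a≤b = dne λ a≢b → chain a≢b lem
    where
    chain : a ≢ b → Dec (b ≡ g b) → ⊥
    chain a≢b (no b≢gb) = no-joinPrime-3-chain jp-a jp-b (g-joinPrime jp-b) a≤b b≤gb a≢b b≢gb
    chain a≢b (yes b≡gb) with lem {P = b ≡ g a}
    ... | yes b≡ga = a≢b (trans (sym (g-involutive jp-a)) (trans (cong g (sym b≡ga)) (sym b≡gb)))
    ... | no b≢ga  = no-joinPrime-3-chain jp-a jp-b (g-joinPrime jp-a) a≤b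
                       (subst (_≤ g a) (sym b≡gb) (g-antitone jp-a a≤b)) a≢b b≢ga

  g≤lower⇒fixed : ∀ {l m} → IsLower l → IsLower m → g l ≤ m → l ≡ m × l ≡ g l
  g≤lower⇒fixed {l} {m} (jp-l , l≤gl) (_ , m≤gm) gl≤m =
    ≤-antisym l≤m m≤l , ≤-antisym l≤gl (≤-trans gl≤m m≤l)
    where
    l≤m : l ≤ m
    l≤m = ≤-trans l≤gl gl≤m
    m≤l : m ≤ l
    m≤l = ≤-trans m≤gm (subst (g m ≤_) (g-involutive jp-l) (g-antitone (g-joinPrime jp-l) gl≤m))

  g≤g⇒≡ : ∀ {l m} → IsLower l → IsLower m → g l ≤ g m → m ≡ l
  g≤g⇒≡ {l} {m} lower-l lower-m gl≤gm = lower-antichain lower-m lower-l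
    (subst₂ _≤_ (g-involutive (proj₁ lower-m)) (g-involutive (proj₁ lower-l))
      (g-antitone (g-joinPrime (proj₁ lower-l)) gl≤gm))

  Strict : Carrier → Carrier → Set ℓ
  Strict a b = a ≤ g b × a ≢ g b

  strict-sym : ∀ {a b} → CompletelyJoinPrime a → CompletelyJoinPrime b → Strict a b → Strict b a
  strict-sym {a} {b} jp-a jp-b (a≤gb , a≢gb) =
    subst (_≤ g a) (g-involutive jp-b) (g-antitone jp-a a≤gb) ,
    λ b≡ga → a≢gb (trans (sym (g-involutive jp-a)) (cong g (sym b≡ga)))

  fixed-not-strict : ∀ {a b} → CompletelyJoinPrime a → CompletelyJoinPrime b → a ≡ g a → ¬ Strict a b
  fixed-not-strict {a} {b} jp-a jp-b a≡ga a<gb@(a≤gb , a≢gb) with strict-sym jp-a jp-b a<gb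
  ... | b≤ga , b≢ga = no-joinPrime-3-chain jp-b jp-a (g-joinPrime jp-b)
                        (subst (b ≤_) (sym a≡ga) b≤ga) a≤gb (λ b≡a → b≢ga (trans b≡a a≡ga)) a≢gb

module RoughSetProperties {a} (U : Set a) {I : Set a} (H : I → Subset U a) where
  open Covering U H

  ≐-sym : ∀ {X Y : Subset U a} → X ≐ Y → Y ≐ X
  ≐-sym X≐Y u = ⇔-sym (X≐Y u)

  ≐-trans : ∀ {X Y Z : Subset U a} → X ≐ Y → Y ≐ Z → X ≐ Z
  ≐-trans X≐Y Y≐Z u = Y≐Z u ⇔-∘ X≐Y u

  ≈ₚ-sym : ∀ {P Q} → P ≈ₚ Q → Q ≈ₚ P
  ≈ₚ-sym (A≐ , B≐) = ≐-sym A≐ , ≐-sym B≐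

  ≈ₚ-trans : ∀ {P Q S} → P ≈ₚ Q → Q ≈ₚ S → P ≈ₚ S
  ≈ₚ-trans (A≐ , B≐) (A≐′ , B≐′) = ≐-trans A≐ A≐′ , ≐-trans B≐ B≐′

  ≈ₚ⇒≤ₚ : ∀ {P Q} → P ≈ₚ Q → P ≤ₚ Q
  ≈ₚ⇒≤ₚ (A≐ , B≐) = (λ u → to (A≐ u)) , (λ u → to (B≐ u))

  ≤ₚ-trans : ∀ {P Q S} → P ≤ₚ Q → Q ≤ₚ S → P ≤ₚ S
  ≤ₚ-trans (A⊆ , B⊆) (A⊆′ , B⊆′) = (λ u → A⊆′ u ∘ A⊆ u) , (λ u → B⊆′ u ∘ B⊆ u)

  ≈ₚ-respˡ-⇔ : ∀ {P P′ Q} → P ≈ₚ P′ → (P ≈ₚ Q) ⇔ (P′ ≈ₚ Q)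
  ≈ₚ-respˡ-⇔ P≈P′ = mk⇔ (≈ₚ-trans (≈ₚ-sym P≈P′)) (≈ₚ-trans P≈P′)

  ≤ₚ-respˡ-⇔ : ∀ {P P′ Q} → P ≈ₚ P′ → (P ≤ₚ Q) ⇔ (P′ ≤ₚ Q)
  ≤ₚ-respˡ-⇔ P≈P′ = mk⇔ (≤ₚ-trans (≈ₚ⇒≤ₚ (≈ₚ-sym P≈P′))) (≤ₚ-trans (≈ₚ⇒≤ₚ P≈P′))

  ↓-cong : ∀ {X Y} → X ≐ Y → (X ↓) ≐ (Y ↓)
  ↓-cong X≐Y u = mk⇔ (λ d v r → to (X≐Y v) (d v r)) (λ d v r → from (X≐Y v) (d v r))

  ↑-cong : ∀ {X Y} → X ≐ Y → (X ↑) ≐ (Y ↑)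
  ↑-cong X≐Y u = mk⇔ (λ (v , r , x) → v , r , to (X≐Y v) x)
                     (λ (v , r , y) → v , r , from (X≐Y v) y)

  ∧ₚ-congˡ : ∀ {P Q Q′} → Q ≈ₚ Q′ → (P ∧ₚ Q) ≈ₚ (P ∧ₚ Q′)
  ∧ₚ-congˡ (A≐ , B≐) =
    (λ u → mk⇔ (λ (p , q) → p , to (A≐ u) q) (λ (p , q) → p , from (A≐ u) q)) ,
    ↑-cong (↓-cong λ u → mk⇔ (λ (p , q) → p , to (B≐ u) q) (λ (p , q) → p , from (B≐ u) q))

module Representation (lem : ∀ {b} → ExcludedMiddle b) {ℓ} (𝕃 : PKleeneAlgebra ℓ)
  (regular : PKleeneAlgebra.Regular 𝕃) (algebraic : PKleeneAlgebra.Algebraic 𝕃) where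
  open PKleeneAlgebra 𝕃
  open LatticeProperties 𝕃
  open Classical lem
  open RegularAlgebraicProperties lem 𝕃 regular algebraic

  -- The witness is resized to make it proof-irrelevant, so that ⌊_⌋ is injective.
  Lower : Set (suc ℓ)
  Lower = Σ Carrier λ j → Resize (suc ℓ) (IsLower j)

  ⌊_⌋ : Lower → Carrier
  ⌊_⌋ = proj₁

  lower-isLower : ∀ l → IsLower ⌊ l ⌋
  lower-isLower l = unresize (proj₂ l)

  lower-joinPrime : ∀ l → CompletelyJoinPrime ⌊ l ⌋
  lower-joinPrime l = proj₁ (lower-isLower l)

  lower-≤g : ∀ l → ⌊ l ⌋ ≤ g ⌊ l ⌋
  lower-≤g l = proj₂ (lower-isLower l)

  ⌊⌋-injective : ∀ {l m} → ⌊ l ⌋ ≡ ⌊ m ⌋ → l ≡ m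
  ⌊⌋-injective {j , r} {.j , r′} refl = cong (j ,_) (Resize-irrelevant r r′)

  lower-≤⇒≡ : ∀ {l m} → ⌊ l ⌋ ≤ ⌊ m ⌋ → l ≡ m
  lower-≤⇒≡ {l} {m} l≤m = ⌊⌋-injective (lower-antichain (lower-isLower l) (lower-isLower m) l≤m)

  lower-≡g⇒≡ : ∀ {l m} → ⌊ l ⌋ ≡ g ⌊ m ⌋ → l ≡ m
  lower-≡g⇒≡ {l} {m} l≡gm = lower-≤⇒≡ (≤-trans (lower-≤g l) (≤-reflexive gl≡m))
    where
    gl≡m : g ⌊ l ⌋ ≡ ⌊ m ⌋
    gl≡m = trans (cong g l≡gm) (g-involutive (lower-joinPrime m))

  lower-g≤⇒fixed : ∀ {l m} → g ⌊ l ⌋ ≤ ⌊ m ⌋ → l ≡ m × ⌊ l ⌋ ≡ g ⌊ l ⌋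
  lower-g≤⇒fixed {l} {m} gl≤m with g≤lower⇒fixed (lower-isLower l) (lower-isLower m) gl≤m
  ... | l≡m , fixed = ⌊⌋-injective l≡m , fixed

  lower-g≤g⇒≡ : ∀ {l m} → g ⌊ l ⌋ ≤ g ⌊ m ⌋ → m ≡ l
  lower-g≤g⇒≡ {l} {m} gl≤gm = ⌊⌋-injective (g≤g⇒≡ (lower-isLower l) (lower-isLower m) gl≤gm)

  StrictPair : Set (suc ℓ)
  StrictPair = Σ Lower λ a → Σ Lower λ b → Strict ⌊ a ⌋ ⌊ b ⌋

  Point : Set (suc ℓ)
  Point = Lower ⊎ StrictPair

  Block : Lower → Subset Point (suc ℓ)
  Block i (inj₁ m)           = m ≡ i
  Block i (inj₂ (a , b , _)) = a ≡ i ⊎ b ≡ i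

  open Covering Point Block
  open RoughSetProperties Point Block

  R-point⇒∈-block : ∀ {l v} → R (inj₁ l) v → Block l v
  R-point⇒∈-block (_ , refl , v∈) = v∈

  some-block : ∀ u → ∃ λ l → Block l u
  some-block (inj₁ l)           = l , refl
  some-block (inj₂ (a , b , _)) = a , inj₁ refl

  fixed-block : ∀ {i u} → ⌊ i ⌋ ≡ g ⌊ i ⌋ → Block i u → u ≡ inj₁ i
  fixed-block {u = inj₁ _} _ refl = refl
  fixed-block {u = inj₂ (a , b , a<b)} fixed (inj₁ refl) =
    ⊥-elim (fixed-not-strict (lower-joinPrime a) (lower-joinPrime b) fixed a<b)
  fixed-block {u = inj₂ (a , b , a<b)} fixed (inj₂ refl) =
    ⊥-elim (fixed-not-strict (lower-joinPrime b) (lower-joinPrime a) fixed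
              (strict-sym (lower-joinPrime a) (lower-joinPrime b) a<b))

  generator : Carrier → Subset Point (suc ℓ)
  generator x (inj₁ m)           = Lift (suc ℓ) (⌊ m ⌋ ≤ x)
  generator x (inj₂ (a , b , _)) = Lift (suc ℓ) (g ⌊ a ⌋ ≤ x ⊎ g ⌊ b ⌋ ≤ x)

  φ↓ : Carrier → Subset Point (suc ℓ)
  φ↓ x u = ∀ l → Block l u → g ⌊ l ⌋ ≤ x

  φ↑ : Carrier → Subset Point (suc ℓ)
  φ↑ x u = ∃ λ l → Block l u × ⌊ l ⌋ ≤ x

  generator-in-block : ∀ {x i v} → Block i v → generator x v → ⌊ i ⌋ ≤ x
  generator-in-block {v = inj₁ _} refl (lift i≤x) = i≤x
  generator-in-block {v = inj₂ (a , _ , _)}   (inj₁ refl) (lift (inj₁ ga≤x)) = ≤-trans (lower-≤g a) ga≤x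
  generator-in-block {v = inj₂ (_ , _ , a<b)} (inj₁ refl) (lift (inj₂ gb≤x)) = ≤-trans (proj₁ a<b) gb≤x
  generator-in-block {v = inj₂ (a , b , a<b)} (inj₂ refl) (lift (inj₁ ga≤x)) =
    ≤-trans (proj₁ (strict-sym (lower-joinPrime a) (lower-joinPrime b) a<b)) ga≤x
  generator-in-block {v = inj₂ (_ , b , _)}   (inj₂ refl) (lift (inj₂ gb≤x)) = ≤-trans (lower-≤g b) gb≤x

  g≤⇒block⊆generator : ∀ {x i v} → g ⌊ i ⌋ ≤ x → Block i v → generator x v
  g≤⇒block⊆generator {i = i} {inj₁ _} gi≤x refl        = lift (≤-trans (lower-≤g i) gi≤x)
  g≤⇒block⊆generator {v = inj₂ _}     gi≤x (inj₁ refl) = lift (inj₁ gi≤x)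
  g≤⇒block⊆generator {v = inj₂ _}     gi≤x (inj₂ refl) = lift (inj₂ gi≤x)

  φ↓≐generator↓ : ∀ x → φ↓ x ≐ (generator x ↓)
  φ↓≐generator↓ x u = mk⇔ (λ u∈ v (i , u∈i , v∈i) → g≤⇒block⊆generator (u∈ i u∈i) v∈i) from′
    where
    from′ : (generator x ↓) u → φ↓ x u
    from′ u∈ l u∈l with lem {P = ⌊ l ⌋ ≡ g ⌊ l ⌋}
    ... | yes fixed = subst (_≤ x) fixed (lower (u∈ (inj₁ l) (l , u∈l , refl)))
    ... | no unfixed = reduce (lower (u∈ (inj₂ (l , l , lower-≤g l , unfixed)) (l , u∈l , inj₁ refl)))

  φ↑≐generator↑ : ∀ x → φ↑ x ≐ (generator x ↑)
  φ↑≐generator↑ x u = mk⇔ (λ (l , u∈l , l≤x) → inj₁ l , (l , u∈l , refl) , lift l≤x)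
                          (λ (v , (i , u∈i , v∈i) , v∈) → i , u∈i , generator-in-block v∈i v∈)

  φ : Carrier → RS
  φ x = (φ↓ x , φ↑ x) , generator x , φ↓≐generator↓ x , φ↑≐generator↑ x

  φ↓-point : ∀ {x i} → g ⌊ i ⌋ ≤ x → φ↓ x (inj₁ i)
  φ↓-point gi≤x _ refl = gi≤x

  φ-mono : ∀ {x y} → x ≤ y → proj₁ (φ x) ≤ₚ proj₁ (φ y)
  φ-mono x≤y = (λ u u∈ l u∈l → ≤-trans (u∈ l u∈l) x≤y)
             , (λ u (l , u∈l , l≤x) → l , u∈l , ≤-trans l≤x x≤y)

  -- A join-prime j ≤ x is itself a lower point or g j is one; the first case is seen by φ↑,
  -- the second by φ↓.
  φ-reflects : ∀ {x y} → proj₁ (φ x) ≤ₚ proj₁ (φ y) → x ≤ y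
  φ-reflects {x} {y} (↓⊆ , ↑⊆) = ≤-by-joinPrimes λ jp j≤x → below jp j≤x (joinPrime-≤g⊎g≤ jp)
    where
    below : ∀ {j} → CompletelyJoinPrime j → j ≤ x → j ≤ g j ⊎ g j ≤ j → j ≤ y
    below {j} jp j≤x (inj₁ j≤gj) with ↑⊆ (inj₁ (j , resize (jp , j≤gj))) (_ , refl , j≤x)
    ... | _ , refl , j≤y = j≤y
    below {j} jp j≤x (inj₂ gj≤j) = subst (_≤ y) (g-involutive jp) (↓⊆ (inj₁ l) l∈φ↓x l refl)
      where
      l : Lower
      l = g j , resize (g-joinPrime jp , subst (g j ≤_) (sym (g-involutive jp)) gj≤j)
      l∈φ↓x : φ↓ x (inj₁ l)
      l∈φ↓x = φ↓-point (subst (_≤ x) (sym (g-involutive jp)) j≤x)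

  φ-injective : ∀ x y → proj₁ (φ x) ≈ₚ proj₁ (φ y) → x ≡ y
  φ-injective x y φx≈φy =
    ≤-antisym (φ-reflects (≈ₚ⇒≤ₚ φx≈φy)) (φ-reflects (≈ₚ⇒≤ₚ (≈ₚ-sym φx≈φy)))

  -- The preimage of the rough set of X: the join of the lower points meeting X↑ and of the
  -- images under g of the lower points in X↓.
  module Preimage (X : Subset Point (suc ℓ)) where

    Summand : Subset Carrier (suc ℓ)
    Summand c = (∃ λ l → (X ↑) (inj₁ l) × c ≡ ⌊ l ⌋) ⊎ (∃ λ l → (X ↓) (inj₁ l) × c ≡ g ⌊ l ⌋)

    x : Carrier
    x = sup λ c → Resize ℓ (Summand c)

    summand-≤x : ∀ {c} → Summand c → c ≤ x
    summand-≤x c∈ = ≤-sup (resize c∈)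

    joinPrime-≤x : ∀ {j} → CompletelyJoinPrime j → j ≤ x → ∃ λ c → Summand c × j ≤ c
    joinPrime-≤x jp j≤x with joinPrime-≤sup jp j≤x
    ... | c , c∈ , j≤c = c , unresize c∈ , j≤c

    φ↓x≐X↓ : φ↓ x ≐ (X ↓)
    φ↓x≐X↓ u = mk⇔ to′ λ u∈ l u∈l →
      summand-≤x (inj₂ (l , (λ v r → u∈ v (l , u∈l , R-point⇒∈-block r)) , refl))
      where
      in-X : ∀ {i v c} → Block i v → Summand c → g ⌊ i ⌋ ≤ c → X v
      in-X {i} v∈i (inj₁ (m , (w , r , w∈X) , refl)) gi≤m with lower-g≤⇒fixed {i} {m} gi≤m
      ... | refl , fixed =
        subst X (trans (fixed-block fixed (R-point⇒∈-block r)) (sym (fixed-block fixed v∈i))) w∈X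
      in-X {i} v∈i (inj₂ (m , m∈X↓ , refl)) gi≤gm with lower-g≤g⇒≡ {i} {m} gi≤gm
      ... | refl = m∈X↓ _ (i , refl , v∈i)

      to′ : φ↓ x u → (X ↓) u
      to′ u∈ v (i , u∈i , v∈i) =
        let (c , c∈ , gi≤c) = joinPrime-≤x (g-joinPrime (lower-joinPrime i)) (u∈ i u∈i)
        in in-X v∈i c∈ gi≤c

    φ↑x≐X↑ : φ↑ x ≐ (X ↑)
    φ↑x≐X↑ u = mk⇔ to′ λ (v , (i , u∈i , v∈i) , v∈X) →
      i , u∈i , summand-≤x (inj₁ (i , (v , (i , refl , v∈i) , v∈X) , refl))
      where
      meets-X : ∀ {l c} → Block l u → Summand c → ⌊ l ⌋ ≤ c → (X ↑) u
      meets-X {l} u∈l (inj₁ (m , (w , r , w∈X) , refl)) l≤m with lower-≤⇒≡ {l} {m} l≤m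
      ... | refl = w , (_ , u∈l , R-point⇒∈-block r) , w∈X
      meets-X {l} u∈l (inj₂ (m , m∈X↓ , refl)) l≤gm with lem {P = ⌊ l ⌋ ≡ g ⌊ m ⌋}
      ... | no l≢gm = inj₂ (l , m , l≤gm , l≢gm) , (l , u∈l , inj₁ refl) , m∈X↓ _ (m , refl , inj₂ refl)
      ... | yes l≡gm with lower-≡g⇒≡ {l} {m} l≡gm
      ...   | refl = inj₁ l , (l , u∈l , refl) , m∈X↓ _ (l , refl , refl)

      to′ : φ↑ x u → (X ↑) u
      to′ (l , u∈l , l≤x) =
        let (c , c∈ , l≤c) = joinPrime-≤x (lower-joinPrime l) l≤x in meets-X u∈l c∈ l≤c

  φ-surjective : ∀ (Z : RS) → ∃ λ x → proj₁ (φ x) ≈ₚ proj₁ Z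
  φ-surjective (_ , X , A≐X↓ , B≐X↑) =
    x , ≐-trans φ↓x≐X↓ (≐-sym A≐X↓) , ≐-trans φ↑x≐X↑ (≐-sym B≐X↑)
    where open Preimage X

  φ-∨ : ∀ x y → proj₁ (φ (x ∨ y)) ≈ₚ (proj₁ (φ x) ∨ₚ proj₁ (φ y))
  φ-∨ x y = (λ u → mk⇔ (↓-to u) (↓-from u)) , (λ u → mk⇔ (↑-to u) (↑-from u))
    where
    ↓-to : ∀ u → φ↓ (x ∨ y) u → (((λ v → φ↓ x v ⊎ φ↓ y v) ↑) ↓) u
    ↓-to u u∈ v (i , u∈i , v∈i) with joinPrime-∨ (g-joinPrime (lower-joinPrime i)) (u∈ i u∈i)
    ... | inj₁ gi≤x = inj₁ i , (i , v∈i , refl) , inj₁ (φ↓-point gi≤x)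
    ... | inj₂ gi≤y = inj₁ i , (i , v∈i , refl) , inj₂ (φ↓-point gi≤y)

    ↓-from : ∀ u → (((λ v → φ↓ x v ⊎ φ↓ y v) ↑) ↓) u → φ↓ (x ∨ y) u
    ↓-from u u∈ l u∈l with u∈ (inj₁ l) (l , u∈l , refl)
    ... | w , r , inj₁ w∈ = ≤-trans (w∈ l (R-point⇒∈-block r)) x≤x∨y
    ... | w , r , inj₂ w∈ = ≤-trans (w∈ l (R-point⇒∈-block r)) y≤x∨y

    ↑-to : ∀ u → φ↑ (x ∨ y) u → φ↑ x u ⊎ φ↑ y u
    ↑-to u (l , u∈l , l≤x∨y) with joinPrime-∨ (lower-joinPrime l) l≤x∨y
    ... | inj₁ l≤x = inj₁ (l , u∈l , l≤x)
    ... | inj₂ l≤y = inj₂ (l , u∈l , l≤y)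

    ↑-from : ∀ u → φ↑ x u ⊎ φ↑ y u → φ↑ (x ∨ y) u
    ↑-from u (inj₁ (l , u∈l , l≤x)) = l , u∈l , ≤-trans l≤x x≤x∨y
    ↑-from u (inj₂ (l , u∈l , l≤y)) = l , u∈l , ≤-trans l≤y y≤x∨y

  φ-∧ : ∀ x y → proj₁ (φ (x ∧ y)) ≈ₚ (proj₁ (φ x) ∧ₚ proj₁ (φ y))
  φ-∧ x y =
    (λ u → mk⇔ (λ u∈ → (λ l u∈l → ≤-trans (u∈ l u∈l) x∧y≤x)
                     , (λ l u∈l → ≤-trans (u∈ l u∈l) x∧y≤y))
               (λ (u∈x , u∈y) l u∈l → ∧-greatest (u∈x l u∈l) (u∈y l u∈l))) ,
    (λ u → mk⇔ (↑-to u) (↑-from u))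
    where
    ↑-to : ∀ u → φ↑ (x ∧ y) u → (((λ v → φ↑ x v × φ↑ y v) ↓) ↑) u
    ↑-to u (l , u∈l , l≤x∧y) = inj₁ l , (l , u∈l , refl) , λ w r →
      (l , R-point⇒∈-block r , ≤-trans l≤x∧y x∧y≤x) ,
      (l , R-point⇒∈-block r , ≤-trans l≤x∧y x∧y≤y)

    ↑-from : ∀ u → (((λ v → φ↑ x v × φ↑ y v) ↓) ↑) u → φ↑ (x ∧ y) u
    ↑-from u (v , (i , u∈i , v∈i) , v∈) with v∈ (inj₁ i) (i , v∈i , refl)
    ... | (_ , refl , i≤x) , (_ , refl , i≤y) = i , u∈i , ∧-greatest i≤x i≤y

  φ-∼ : ∀ x → proj₁ (φ (∼ x)) ≈ₚ ∼ₚ (φ x)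
  φ-∼ x = (λ u → mk⇔ (↓-to u) (↓-from u)) , (λ u → mk⇔ (↑-to u) (↑-from u))
    where
    ↓-to : ∀ u → φ↓ (∼ x) u → (∁ (generator x) ↓) u
    ↓-to u u∈ v (i , u∈i , v∈i) v∈ =
      g≤∼⇒≰ (lower-joinPrime i) (u∈ i u∈i) (generator-in-block v∈i v∈)

    ↓-from : ∀ u → (∁ (generator x) ↓) u → φ↓ (∼ x) u
    ↓-from u u∈ l u∈l = ≰⇒g≤∼ λ l≤x → u∈ (inj₁ l) (l , u∈l , refl) (lift l≤x)

    ↑-to : ∀ u → φ↑ (∼ x) u → (∁ (generator x) ↑) u
    ↑-to u (l , u∈l , l≤∼x) = witness lem
      where
      gl≰x : ¬ g ⌊ l ⌋ ≤ x
      gl≰x = ≤∼⇒g≰ (lower-joinPrime l) l≤∼x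
      witness : Dec (⌊ l ⌋ ≡ g ⌊ l ⌋) → (∁ (generator x) ↑) u
      witness (yes fixed)  = inj₁ l , (l , u∈l , refl) , λ (lift l≤x) → gl≰x (subst (_≤ x) fixed l≤x)
      witness (no unfixed) = inj₂ (l , l , lower-≤g l , unfixed) , (l , u∈l , inj₁ refl) ,
                             λ (lift gl≤x) → gl≰x (reduce gl≤x)

    ↑-from : ∀ u → (∁ (generator x) ↑) u → φ↑ (∼ x) u
    ↑-from u (v , (i , u∈i , v∈i) , v∉) =
      i , u∈i , g≰⇒≤∼ (lower-joinPrime i) λ gi≤x → v∉ (g≤⇒block⊆generator gi≤x v∈i)

  φ-𝟘 : proj₁ (φ 𝟘) ≈ₚ 𝟘ₚ
  φ-𝟘 = (λ u → mk⇔ (λ u∈ → let (l , u∈l) = some-block u in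
                           ⊥-elim (joinPrime⇒≰𝟘 (g-joinPrime (lower-joinPrime l)) (u∈ l u∈l))) λ ())
      , (λ u → mk⇔ (λ (l , _ , l≤𝟘) → ⊥-elim (joinPrime⇒≰𝟘 (lower-joinPrime l) l≤𝟘)) λ ())

  φ-𝟙 : proj₁ (φ 𝟙) ≈ₚ 𝟙ₚ
  φ-𝟙 = (λ u → mk⇔ (λ _ → lift tt) (λ _ l _ → 𝟙-greatest (g ⌊ l ⌋)))
      , (λ u → mk⇔ (λ _ → lift tt) (λ _ → let (l , u∈l) = some-block u in
                                             l , u∈l , 𝟙-greatest ⌊ l ⌋))

  φ≈𝟘ₚ⇔≡𝟘 : ∀ {x} → (proj₁ (φ x) ≈ₚ 𝟘ₚ) ⇔ (x ≡ 𝟘)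
  φ≈𝟘ₚ⇔≡𝟘 {x} = mk⇔ (λ φx≈𝟘 → φ-injective x 𝟘 (≈ₚ-trans φx≈𝟘 (≈ₚ-sym φ-𝟘))) λ { refl → φ-𝟘 }

  φ-* : ∀ x → IsPseudocomplementRS (proj₁ (φ x)) (proj₁ (φ (x *)))
  φ-* x = proj₂ (φ (x *)) , λ Z → let (z , φz≈Z) = φ-surjective Z in begin
    ((proj₁ (φ x) ∧ₚ proj₁ Z) ≈ₚ 𝟘ₚ)            ∼⟨ ≈ₚ-respˡ-⇔ (∧ₚ-congˡ (≈ₚ-sym φz≈Z)) ⟩
    ((proj₁ (φ x) ∧ₚ proj₁ (φ z)) ≈ₚ 𝟘ₚ)        ∼⟨ ≈ₚ-respˡ-⇔ (≈ₚ-sym (φ-∧ x z)) ⟩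
    (proj₁ (φ (x ∧ z)) ≈ₚ 𝟘ₚ)                   ∼⟨ φ≈𝟘ₚ⇔≡𝟘 ⟩
    (x ∧ z ≡ 𝟘)                                 ∼⟨ pseudocomplement x z ⟩
    (z ≤ x *)                                   ∼⟨ mk⇔ φ-mono φ-reflects ⟩
    (proj₁ (φ z) ≤ₚ proj₁ (φ (x *)))            ∼⟨ ≤ₚ-respˡ-⇔ φz≈Z ⟩
    (proj₁ Z ≤ₚ proj₁ (φ (x *)))                ∎
    where open EquationalReasoning {k = equivalence}

  φ-isRSIsomorphism : IsRSIsomorphism 𝕃 Point Block φ
  φ-isRSIsomorphism = φ-injective , φ-surjective , φ-∨ , φ-∧ , φ-∼ , φ-* , φ-𝟘 , φ-𝟙

  blocks-isCovering : IsCovering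
  blocks-isCovering = (λ i → inj₁ i , refl) , some-block

  blocks-irredundant : Irredundant
  blocks-irredundant i = inj₁ i , λ { _ refl u → ⇔-id _ }

theorem5p3 : (∀ {b} → ExcludedMiddle b) →
  ∀ {ℓ} (𝕃 : PKleeneAlgebra ℓ) →
  PKleeneAlgebra.Regular 𝕃 →
  PKleeneAlgebra.Algebraic 𝕃 →
  Σ (Set (suc ℓ)) λ U →
  Σ (Set (suc ℓ)) λ I →
  Σ (I → Subset U (suc ℓ)) λ H →
    Covering.IsCovering U H ×
    Covering.Irredundant U H ×
    Σ (PKleeneAlgebra.Carrier 𝕃 → Covering.RS U H) (IsRSIsomorphism 𝕃 U H)
theorem5p3 lem 𝕃 regular algebraic =
  Point , Lower , Block , blocks-isCovering , blocks-irredundant , φ , φ-isRSIsomorphism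
  where open Representation lem 𝕃 regular algebraic
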